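{- Let $(G,\pi_0)$ be a colored graph and let $\nu_1,\nu_2$ be nodes of the search tree $\mathcal T(G,\pi_0)$ with $|\nu_1|=|\nu_2|$ and $\bar\phi(G,\pi_0,\nu_1)=\bar\phi(G,\pi_0,\nu_2)$. Then there is a proof for $(G,\pi_0)$ in the proof system described in the context that derives the fact $\bar\phi(G,\pi_0,\nu_1)=\bar\phi(G,\pi_0,\nu_2)$.
   Context: Graphs and colorings: $G=(V,E)$ is a finite undirected graph with $V=\{1,\dots,n\}$. A coloring is a surjection $\pi:V\to\{1,\dots,m\}$, identified with the ordered sequence of its cells. $\pi'\preceq\pi$ means that $\pi(u)<\pi(v)$ implies $\pi'(u)<\pi'(v)$; $\pi'\prec\pi$ means $\pi'\preceq\pi$ and $\pi'\ne\pi$. A coloring is discrete if all cells are singletons. Permutations act by $G^\sigma=(V,\{(u^\sigma,v^\sigma):(u,v)\in E\})$ and $\pi^\sigma(v^\sigma)=\pi(v)$. For $\nu=[v_1,\dots,v_k]$: $|\nu|=k$, $[\nu,w]=[v_1,\dots,v_k,w]$. Refinement: the procedure make\_equitable$(G,\pi,\alpha)$, with $\alpha$ a list of cells of $\pi$, works as follows. Set $\pi':=\pi$. While $\pi'$ is not discrete and $\alpha\ne\emptyset$: 1. Let $W$ be the first cell of $\pi'$ lying in $\alpha$. Remove it from $\alpha$. 2. For each non-singleton cell $X$ of $\pi'$: - partition $X$ into the classes $X_1,\dots,X_k$ of vertices with equal numbers of neighbours in $W$, ordered by increasing number; - let $j$ be the smallest index with $|X_j|$ maximal; - replace $X$ in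 place by $X_1,\dots,X_{j-1},X_{j+1},\dots,X_k,X_j$; - add each $X_i$ ($i\ne j$) to $\alpha$, and if $X\in\alpha$, replace it by $X_j$. Return $\pi'$. The refinement function $\bar R$ is defined recursively: - $\bar R(G,\pi_0,[\,])=$make\_equitable$(G,\pi_0,\text{all cells of }\pi_0)$; - $\bar R(G,\pi_0,[\nu',v])=$make\_equitable$(G,\pi'',[\{v\}])$, where $\pi''$ is $\bar R(G,\pi_0,\nu')$ with the cell $W\ni v$ replaced in place by $\{v\},W\setminus\{v\}$. Search tree: $\bar T(G,\pi_0,\nu)$ is the first non-singleton cell of $\bar R(G,\pi_0,\nu)$, or $\emptyset$. The search tree $\mathcal T(G,\pi_0)$ has root $[\,]$; the children of $\nu$ are $[\nu,w]$ for $w\in\bar T(G,\pi_0,\nu)$. Invariants: fix a function hash from colored graphs to a totally ordered set with hash$(G^\sigma,\pi^\sigma)=$hash$(G,\pi)$. Then $\bar\phi(G,\pi_0,[v_1,\dots,v_k])=[h_1,\dots,h_k]$ with $h_i=$hash$(G,\bar R(G,\pi_0,[v_1,\dots,v_i]))$. Relevant part of the proof system for fixed $(G,\pi_0)$. A proof is a finite sequence of rule applications whose premises are derived earlier and whose side conditions hold; any rules of the full system may be used, the relevant ones being below. $\operatorname{ind}(\pi,v)$ replaces the cell $W\ni v$ in place by $\{v\},W\setminus\{v\}$. $\operatorname{split}(G,\pi,i)$ replaces each cell by the fragments of vertices with equal numbers of neighbours in the $i$-th cell of $\pi$, sorted ascending, with the first maximum-size fragment moved to the end. - ColoringAxiom: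 $\Rightarrow\bar R(G,\pi_0,[\,])\preceq\pi_0$. - Individualize: $\bar R(G,\pi_0,\nu)=\pi\Rightarrow\bar R(G,\pi_0,[\nu,v])\preceq\operatorname{ind}(\pi,v)$. - SplitColoring: $\bar R(G,\pi_0,\nu)\preceq\pi\Rightarrow\bar R(G,\pi_0,\nu)\preceq\operatorname{split}(G,\pi,i)$ with $i=\min\{j:\operatorname{split}(G,\pi,j)\prec\pi\}$, provided it exists. - Equitable: $\bar R(G,\pi_0,\nu)\preceq\pi\Rightarrow\bar R(G,\pi_0,\nu)=\pi$, provided $\operatorname{split}(G,\pi,i)=\pi$ for all $i$. - InvariantAxiom: $\Rightarrow\bar\phi(G,\pi_0,\nu)=\bar\phi(G,\pi_0,\nu)$. - InvariantsEqual: $\bar\phi(G,\pi_0,\nu')=\bar\phi(G,\pi_0,\nu'')$, $\bar R(G,\pi_0,[\nu',v'])=\pi_1$, $\bar R(G,\pi_0,[\nu'',v''])=\pi_2\Rightarrow\bar\phi(G,\pi_0,[\nu',v'])=\bar\phi(G,\pi_0,[\nu'',v''])$, provided hash$(G,\pi_1)=$hash$(G,\pi_2)$. - InvariantsEqualSym: $\bar\phi(G,\pi_0,\nu')=\bar\phi(G,\pi_0,\nu'')\Rightarrow\bar\phi(G,\pi_0,\nu'')=\bar\phi(G,\pi_0,\nu')$. -}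

module Defs where

open import Data.Nat using (ℕ; zero; suc; _+_; _<_; _≡ᵇ_; _⊔_)
open import Data.Bool using (Bool; true; false; if_then_else_; not; _∧_)
open import Data.Fin using (Fin; toℕ)
open import Data.Fin.Properties using (_≟_)
open import Data.Fin.Permutation using (Permutation′; _⟨$⟩ʳ_; _⟨$⟩ˡ_)
open import Data.List using (List; []; _∷_; [_]; _++_; map; length; filterᵇ; upTo; allFin; lookup; concatMap; foldr; null)
open import Data.Bool.ListAction using (any; all)
import Data.List.Properties as LP
open import Data.List.Membership.Propositional using (_∈_)
open import Data.Maybe using (Maybe; just; nothing)
open import Data.Product using (_×_; _,_; ∃)
open import Relation.Nullary using (¬_)
open import Relation.Nullary.Decidable using (⌊_⌋)
open import Relation.Binary.PropositionalEquality using (_≡_; _≢_; sym)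

record Graph (n : ℕ) : Set where
  field
    adj : Fin n → Fin n → Bool
    adj-sym : ∀ u v → adj u v ≡ adj v u
open Graph public

-- G^σ : edge (u,v) becomes (u^σ, v^σ)
permGraph : ∀ {n} → Permutation′ n → Graph n → Graph n
permGraph σ G = record
  { adj = λ u v → adj G (σ ⟨$⟩ˡ u) (σ ⟨$⟩ˡ v)
  ; adj-sym = λ u v → adj-sym G (σ ⟨$⟩ˡ u) (σ ⟨$⟩ˡ v) }

-- Colorings as ordered sequences of cells.  Every cell is stored as the
-- list of its vertices in increasing order (canonical representation).

Cell : ℕ → Set
Cell n = List (Fin n)

Coloring : ℕ → Set
Coloring n = List (Cell n)

_==_ : ∀ {n} → Fin n → Fin n → Bool
u == v = ⌊ u ≟ v ⌋

_==c_ : ∀ {n} → Cell n → Cell n → Bool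
X ==c Y = ⌊ LP.≡-dec _≟_ X Y ⌋

_∈ᵇ_ : ∀ {n} → Fin n → Cell n → Bool
v ∈ᵇ X = any (v ==_) X

cellsOf : ∀ {n m} → (Fin n → Fin m) → Coloring n
cellsOf {n} {m} π = map (λ c → filterᵇ (λ v → π v == c) (allFin n)) (allFin m)

colorOf : ∀ {n} → Coloring n → Fin n → ℕ
colorOf [] v = 0
colorOf (X ∷ Xs) v = if v ∈ᵇ X then 0 else suc (colorOf Xs v)

_⪯_ : ∀ {n} → Coloring n → Coloring n → Set
π' ⪯ π = ∀ u v → colorOf π u < colorOf π v → colorOf π' u < colorOf π' v

_≺_ : ∀ {n} → Coloring n → Coloring n → Set
π' ≺ π = (π' ⪯ π) × (π' ≢ π)

-- π^σ : cell X becomes X^σ (kept in canonical increasing order)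
permColoring : ∀ {n} → Permutation′ n → Coloring n → Coloring n
permColoring {n} σ π = map (λ X → filterᵇ (λ u → (σ ⟨$⟩ˡ u) ∈ᵇ X) (allFin n)) π

discrete : ∀ {n} → Coloring n → Bool
discrete π = all (λ X → length X ≡ᵇ 1) π

degIn : ∀ {n} → Graph n → Cell n → Fin n → ℕ
degIn G W v = length (filterᵇ (adj G v) W)

classes : ∀ {n} → Graph n → Cell n → Cell n → List (Cell n)
classes G W X =
  filterᵇ (λ C → not (null C))
    (map (λ k → filterᵇ (λ v → degIn G W v ≡ᵇ k) X) (upTo (suc (length W))))

maxLen : ∀ {n} → List (Cell n) → ℕ
maxLen = foldr (λ C m → length C ⊔ m) 0

extract : ∀ {n} → ℕ → List (Cell n) → Cell n × List (Cell n)
extract m [] = [] , []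
extract m (C ∷ Cs) with length C ≡ᵇ m
... | true = C , Cs
... | false with extract m Cs
...   | (X , R) = X , (C ∷ R)

splitCell : ∀ {n} → Graph n → Cell n → Cell n → List (Cell n) × Cell n
splitCell G W X with extract (maxLen (classes G W X)) (classes G W X)
... | (Xj , rest) = rest , Xj

splitCells : ∀ {n} → Graph n → Cell n → Coloring n → Coloring n
splitCells G W π = concatMap (λ X → let (r , Xj) = splitCell G W X in r ++ [ Xj ]) π

split : ∀ {n} → Graph n → (π : Coloring n) → Fin (length π) → Coloring n
split G π i = splitCells G (lookup π i) π

replaceCell : ∀ {n} → Cell n → Cell n → List (Cell n) → List (Cell n)
replaceCell X Y α = map (λ C → if C ==c X then Y else C) α

removeCell : ∀ {n} → Cell n → List (Cell n) → List (Cell n)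
removeCell X [] = []
removeCell X (C ∷ α) = if C ==c X then α else C ∷ removeCell X α

memCell : ∀ {n} → Cell n → List (Cell n) → Bool
memCell X α = any (_==c X) α

firstIn : ∀ {n} → Coloring n → List (Cell n) → Maybe (Cell n)
firstIn [] α = nothing
firstIn (X ∷ π) α = if memCell X α then just X else firstIn π α

refineStep : ∀ {n} → Graph n → Cell n → Coloring n → List (Cell n) → Coloring n × List (Cell n)
refineStep G W [] α = [] , α
refineStep G W (X ∷ Xs) α with length X ≡ᵇ 1
... | true with refineStep G W Xs α
...   | (π , α') = (X ∷ π) , α'
refineStep G W (X ∷ Xs) α | false with splitCell G W X
... | (r , Xj) with refineStep G W Xs (replaceCell X Xj α ++ r)
...   | (π , α') = (r ++ Xj ∷ π) , α'

-- the while loop, run with fuel; the fuel given below (|α|+n+1) is never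
-- exhausted, since every iteration removes a cell from α and at most n
-- new cells are ever added to α
equitableLoop : ∀ {n} → ℕ → Graph n → Coloring n → List (Cell n) → Coloring n
equitableLoop zero G π α = π
equitableLoop (suc f) G π [] = π
equitableLoop (suc f) G π (A ∷ α) with discrete π | firstIn π (A ∷ α)
... | true | _ = π
... | false | nothing = π
... | false | just W with refineStep G W π (removeCell W (A ∷ α))
...   | (π' , α') = equitableLoop f G π' α'

make-equitable : ∀ {n} → Graph n → Coloring n → List (Cell n) → Coloring n
make-equitable {n} G π α = equitableLoop (length α + n + 1) G π α

ind : ∀ {n} → Coloring n → Fin n → Coloring n
ind π v = concatMap f π
  where
  f : _ → _
  f W = if v ∈ᵇ W
        then ([ v ] ∷ (let R = filterᵇ (λ u → not (u == v)) W in if null R then [] else [ R ]))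
        else [ W ]

-- R̄(G,π₀,ν); ν = [v₁,…,v_k] and [ν',v] is ν' ++ [ v ]
Rbar : ∀ {n} → Graph n → Coloring n → List (Fin n) → Coloring n
Rbar G π₀ ν = Data.List.foldl (λ π v → make-equitable G (ind π v) [ [ v ] ])
                              (make-equitable G π₀ π₀) ν
  where import Data.List

firstNonSingleton : ∀ {n} → Coloring n → Cell n
firstNonSingleton [] = []
firstNonSingleton (X ∷ π) = if length X ≡ᵇ 1 then firstNonSingleton π else X

Tbar : ∀ {n} → Graph n → Coloring n → List (Fin n) → Cell n
Tbar G π₀ ν = firstNonSingleton (Rbar G π₀ ν)

data IsNode {n} (G : Graph n) (π₀ : Coloring n) : List (Fin n) → Set where
  root  : IsNode G π₀ []
  child : ∀ {ν w} → IsNode G π₀ ν → w ∈ Tbar G π₀ ν → IsNode G π₀ (ν ++ [ w ])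

prefixes : ∀ {A : Set} → List A → List (List A)
prefixes [] = []
prefixes (x ∷ xs) = [ x ] ∷ map (x ∷_) (prefixes xs)

phibar : ∀ {n} {H : Set} → (Graph n → Coloring n → H) → Graph n → Coloring n → List (Fin n) → List H
phibar hash G π₀ ν = map (λ p → hash G (Rbar G π₀ p)) (prefixes ν)

HashInvariant : ∀ {n} {H : Set} → (Graph n → Coloring n → H) → Set
HashInvariant {n} hash = ∀ (σ : Permutation′ n) G π → hash (permGraph σ G) (permColoring σ π) ≡ hash G π

-- The proof system (relevant rules) for fixed (G, π₀)

data Fact (n : ℕ) : Set where
  R⪯ : List (Fin n) → Coloring n → Fact n      -- R̄(G,π₀,ν) ⪯ π
  R≡ : List (Fin n) → Coloring n → Fact n      -- R̄(G,π₀,ν) = π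
  φ≡ : List (Fin n) → List (Fin n) → Fact n    -- φ̄(G,π₀,ν') = φ̄(G,π₀,ν'')

data Derivable {n} {H : Set} (hash : Graph n → Coloring n → H)
               (G : Graph n) (π₀ : Coloring n) : Fact n → Set where
  ColoringAxiom : Derivable hash G π₀ (R⪯ [] π₀)
  Individualize : ∀ {ν π} v → Derivable hash G π₀ (R≡ ν π) →
                  Derivable hash G π₀ (R⪯ (ν ++ [ v ]) (ind π v))
  SplitColoring : ∀ {ν π} (i : Fin (length π)) →
                  split G π i ≺ π →
                  (∀ (j : Fin (length π)) → toℕ j < toℕ i → ¬ (split G π j ≺ π)) →
                  Derivable hash G π₀ (R⪯ ν π) →
                  Derivable hash G π₀ (R⪯ ν (split G π i))
  Equitable     : ∀ {ν π} → (∀ (i : Fin (length π)) → split G π i ≡ π) →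
                  Derivable hash G π₀ (R⪯ ν π) →
                  Derivable hash G π₀ (R≡ ν π)
  InvariantAxiom : ∀ ν → Derivable hash G π₀ (φ≡ ν ν)
  InvariantsEqual : ∀ {ν' ν'' v' v'' π₁ π₂} →
                  hash G π₁ ≡ hash G π₂ →
                  Derivable hash G π₀ (φ≡ ν' ν'') →
                  Derivable hash G π₀ (R≡ (ν' ++ [ v' ]) π₁) →
                  Derivable hash G π₀ (R≡ (ν'' ++ [ v'' ]) π₂) →
                  Derivable hash G π₀ (φ≡ (ν' ++ [ v' ]) (ν'' ++ [ v'' ]))
  InvariantsEqualSym : ∀ {ν' ν''} → Derivable hash G π₀ (φ≡ ν' ν'') →
                  Derivable hash G π₀ (φ≡ ν'' ν')

-- Both invariant sequences are built from the colorings R̄(G,π₀,ν), so the heart of the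
-- proof is that R̄(G,π₀,ν) = π is derivable for every sequence ν.  We replay make_equitable:
-- each refinement against the first queued cell W becomes a SplitColoring step.  That W is
-- the minimal index demanded by the rule follows from an invariant of the queue: a cell
-- that is not queued, together with some earlier cells, forms a union against which every
-- cell is already uniform.  Hence no cell in front of W splits anything, and once nothing
-- is queued (or the coloring is discrete) the coloring is equitable, which is the rule
-- Equitable.  Individualizing v restores the invariant with queue [{v}], because v's old
-- cell is the union of {v} and its remainder.  Equal invariants then follow by induction
-- on the common length with InvariantsEqual.

module Submission where

open import Defs
open import Data.Nat using (ℕ)
open import Data.Fin using (Fin)
open import Data.List using (List; length)
open import Data.Product using (∃)
open import Relation.Binary using (IsStrictTotalOrder)
open import Relation.Binary.PropositionalEquality using (_≡_)
open import Data.Nat using (zero; suc; _+_; _<_; _≤_; _≡ᵇ_; z≤n; s≤s)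
import Data.Nat.Properties as ℕ
open import Data.Nat.Tactic.RingSolver using (solve-∀)
open import Data.Bool using (Bool; true; false; if_then_else_; not; T; T?)
open import Data.Bool.Properties using (T-≡)
open import Data.Maybe using (just; nothing)
open import Data.Fin using (toℕ; fromℕ<)
import Data.Fin as Fin
import Data.Fin.Properties as Fin
open import Data.List using ([]; _∷_; [_]; _++_; _∷ʳ_; map; filterᵇ; upTo; allFin; lookup; concatMap; concat; null)
import Data.List.Properties as List
open import Data.List.Reverse using (Reverse; reverseView; []; _∶_∶ʳ_)
open import Data.List.Membership.Propositional using (_∈_; _∉_; find; lose)
open import Data.List.Membership.Propositional.Properties
  using (∈-filter⁻; ∈-filter⁺; ∈-++⁺ˡ; ∈-++⁺ʳ; ∈-++⁻; ∈-map⁻; ∈-allFin; ∈-upTo⁺; ∈-concat⁺′; ∈-concat⁻; ∈-concatMap⁺; ∈-concatMap⁻; ∈-lookup)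
open import Data.List.Relation.Unary.Any using (Any; here; there)
import Data.List.Relation.Unary.Any as Any
open import Data.List.Relation.Unary.Any.Properties using (any⁺; any⁻)
open import Data.List.Relation.Unary.All using (All; []; _∷_)
import Data.List.Relation.Unary.All as All
import Data.List.Relation.Unary.All.Properties as All
open import Data.List.Relation.Unary.AllPairs using ([]; _∷_)
open import Data.List.Relation.Unary.Unique.Propositional using (Unique)
open import Data.List.Relation.Unary.Unique.Propositional.Properties using (allFin⁺; upTo⁺)
open import Data.List.Relation.Binary.Permutation.Propositional
import Data.List.Relation.Binary.Permutation.Setoid.Properties as Permₛ
open import Data.List.Relation.Binary.Subset.Propositional using (_⊆_)
open import Data.List.Relation.Binary.Permutation.Propositional.Properties
open import Data.Product using (_×_; _,_; ∃₂; proj₁; proj₂)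
import Data.Product as Prod
open import Data.Sum using (_⊎_; inj₁; inj₂; [_,_]′)
open import Function using (_∘_)
open import Function.Bundles using (Equivalence)
open import Relation.Nullary using (¬_; yes; no; contradiction)
open import Relation.Nullary.Decidable using (toWitness; fromWitness)
open import Relation.Binary using (DecidableEquality)
open import Relation.Binary.PropositionalEquality
  using (_≢_; refl; sym; setoid; cong; cong₂; subst; module ≡-Reasoning)
  renaming (trans to ≡-trans)

T⇒≡true : ∀ {b} → T b → b ≡ true
T⇒≡true = Equivalence.to T-≡

≡true⇒T : ∀ {b} → b ≡ true → T b
≡true⇒T = Equivalence.from T-≡

true≢false : true ≢ false
true≢false ()

module _ {n : ℕ} where

  ==⇒≡ : {u v : Fin n} → u == v ≡ true → u ≡ v
  ==⇒≡ = toWitness ∘ ≡true⇒T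

  ==-refl : (u : Fin n) → u == u ≡ true
  ==-refl u = T⇒≡true (fromWitness refl)

  ∈ᵇ⇒∈ : ∀ {v : Fin n} X → v ∈ᵇ X ≡ true → v ∈ X
  ∈ᵇ⇒∈ X eq = Any.map toWitness (any⁻ _ X (≡true⇒T eq))

  ∈⇒∈ᵇ : ∀ {v : Fin n} {X} → v ∈ X → v ∈ᵇ X ≡ true
  ∈⇒∈ᵇ v∈X = T⇒≡true (any⁺ _ (Any.map fromWitness v∈X))

  ∈ᵇ-false⇒∉ : ∀ {v : Fin n} {X} → v ∈ᵇ X ≡ false → v ∉ X
  ∈ᵇ-false⇒∉ eq v∈X = true≢false (≡-trans (sym (∈⇒∈ᵇ v∈X)) eq)

  ∉⇒∈ᵇ-false : ∀ {v : Fin n} {X} → v ∉ X → v ∈ᵇ X ≡ false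
  ∉⇒∈ᵇ-false {v} {X} v∉X with v ∈ᵇ X in eq
  ... | true  = contradiction (∈ᵇ⇒∈ X eq) v∉X
  ... | false = refl

  ==c⇒≡ : {X Y : Cell n} → X ==c Y ≡ true → X ≡ Y
  ==c⇒≡ = toWitness ∘ ≡true⇒T

  ==c-refl : (X : Cell n) → X ==c X ≡ true
  ==c-refl X = T⇒≡true (fromWitness refl)

  memCell⇒∈ : ∀ {X : Cell n} α → memCell X α ≡ true → X ∈ α
  memCell⇒∈ α eq = Any.map (sym ∘ toWitness) (any⁻ _ α (≡true⇒T eq))

  memCell-false⇒∉ : ∀ {X : Cell n} {α} → memCell X α ≡ false → X ∉ α
  memCell-false⇒∉ eq X∈α = true≢false (≡-trans (sym (T⇒≡true (any⁺ _ (Any.map (fromWitness ∘ sym) X∈α)))) eq)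

_≟ᶜ_ : ∀ {n} → DecidableEquality (Cell n)
_≟ᶜ_ = List.≡-dec Fin._≟_

≡ᵇ⇒≡ : ∀ {a b : ℕ} → (a ≡ᵇ b) ≡ true → a ≡ b
≡ᵇ⇒≡ {a} {b} eq = ℕ.≡ᵇ⇒≡ a b (≡true⇒T eq)

≡⇒≡ᵇ : ∀ {a b : ℕ} → a ≡ b → (a ≡ᵇ b) ≡ true
≡⇒≡ᵇ {a} {b} eq = T⇒≡true (ℕ.≡⇒≡ᵇ a b eq)

≡ᵇ-refl : ∀ a → (a ≡ᵇ a) ≡ true
≡ᵇ-refl a = ≡⇒≡ᵇ {a} {a} refl

module _ {A : Set} (p : A → Bool) where

  ∈-filterᵇ⁻ : ∀ {x} xs → x ∈ filterᵇ p xs → x ∈ xs × p x ≡ true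
  ∈-filterᵇ⁻ xs x∈ = Prod.map₂ T⇒≡true (∈-filter⁻ (T? ∘ p) x∈)

  ∈-filterᵇ⁺ : ∀ {x xs} → x ∈ xs → p x ≡ true → x ∈ filterᵇ p xs
  ∈-filterᵇ⁺ x∈ px = ∈-filter⁺ (T? ∘ p) x∈ (≡true⇒T px)

  filterᵇ-all : ∀ xs → (∀ {x} → x ∈ xs → p x ≡ true) → filterᵇ p xs ≡ xs
  filterᵇ-all xs h = List.filter-all (T? ∘ p) (All.tabulate (≡true⇒T ∘ h))

concat-↭ : ∀ {A : Set} {xss yss : List (List A)} → xss ↭ yss → concat xss ↭ concat yss
concat-↭ refl = refl
concat-↭ (prep xs p) = ++⁺ˡ xs (concat-↭ p)
concat-↭ (trans p q) = ↭-trans (concat-↭ p) (concat-↭ q)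
concat-↭ (swap {xs = xss} {ys = yss} xs ys p) = begin
  xs ++ ys ++ concat xss   ≡⟨ List.++-assoc xs ys _ ⟨
  (xs ++ ys) ++ concat xss ↭⟨ ++⁺ (++-comm xs ys) (concat-↭ p) ⟩
  (ys ++ xs) ++ concat yss ≡⟨ List.++-assoc ys xs _ ⟩
  ys ++ xs ++ concat yss   ∎
  where open PermutationReasoning

concat-nonnull : ∀ {A : Set} (xss : List (List A)) → concat (filterᵇ (not ∘ null) xss) ≡ concat xss
concat-nonnull [] = refl
concat-nonnull ([] ∷ xss) = concat-nonnull xss
concat-nonnull ((x ∷ xs) ∷ xss) = cong ((x ∷ xs) ++_) (concat-nonnull xss)

Unique-↭ : ∀ {A : Set} {xs ys : List A} → xs ↭ ys → Unique xs → Unique ys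
Unique-↭ {A} p = Permₛ.Unique-resp-↭ (setoid A) (↭⇒↭ₛ p)

Unique-++⁻ʳ : ∀ {A : Set} (xs : List A) {ys} → Unique (xs ++ ys) → Unique ys
Unique-++⁻ʳ [] u = u
Unique-++⁻ʳ (x ∷ xs) (_ ∷ u) = Unique-++⁻ʳ xs u

Unique-++⁻ˡ : ∀ {A : Set} (xs : List A) {ys} → Unique (xs ++ ys) → Unique xs
Unique-++⁻ˡ [] u = []
Unique-++⁻ˡ (x ∷ xs) (x∉ ∷ u) = All.++⁻ˡ xs x∉ ∷ Unique-++⁻ˡ xs u

Unique-++⇒disjoint : ∀ {A : Set} (xs : List A) {ys x} → Unique (xs ++ ys) → x ∈ xs → x ∉ ys
Unique-++⇒disjoint (x ∷ xs) (x∉ ∷ u) (here refl) x∈ys = All.lookup (All.++⁻ʳ xs x∉) x∈ys refl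
Unique-++⇒disjoint (x ∷ xs) (_ ∷ u) (there x∈xs) = Unique-++⇒disjoint xs u x∈xs

Unique-concat⇒Unique : ∀ {A : Set} (xss : List (List A)) {xs} → Unique (concat xss) → xs ∈ xss → Unique xs
Unique-concat⇒Unique (xs ∷ xss) u (here refl) = Unique-++⁻ˡ xs u
Unique-concat⇒Unique (ys ∷ xss) u (there xs∈) = Unique-concat⇒Unique xss (Unique-++⁻ʳ ys u) xs∈

module Fibres {A B : Set} (_≈ᵇ_ : B → B → Bool)
  (≈ᵇ⇒≡ : ∀ {a b} → a ≈ᵇ b ≡ true → a ≡ b) (≈ᵇ-refl : ∀ a → a ≈ᵇ a ≡ true) (key : A → B) where

  fibre : B → List A → List A
  fibre k = filterᵇ (λ x → key x ≈ᵇ k)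

  fibres : List B → List A → List A
  fibres ks xs = concat (map (λ k → fibre k xs) ks)

  fibres-∉ : ∀ ks x xs → key x ∉ ks → fibres ks (x ∷ xs) ≡ fibres ks xs
  fibres-∉ [] x xs _ = refl
  fibres-∉ (k ∷ ks) x xs x∉ with key x ≈ᵇ k in eq
  ... | true  = contradiction (here (≈ᵇ⇒≡ eq)) x∉
  ... | false = cong (fibre k xs ++_) (fibres-∉ ks x xs (x∉ ∘ there))

  fibres-∈ : ∀ ks x xs → Unique ks → key x ∈ ks → fibres ks (x ∷ xs) ↭ x ∷ fibres ks xs
  fibres-∈ (k ∷ ks) x xs (k∉ ∷ _) (here refl)
    rewrite ≈ᵇ-refl (key x) | fibres-∉ ks x xs (λ x∈ → All.lookup k∉ x∈ refl) = refl
  fibres-∈ (k ∷ ks) x xs (k∉ ∷ u) (there x∈) with key x ≈ᵇ k in eq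
  ... | true  = contradiction (sym (≈ᵇ⇒≡ eq)) (All.lookup k∉ x∈)
  ... | false = ↭-trans (++⁺ˡ (fibre k xs) (fibres-∈ ks x xs u x∈)) (shift x (fibre k xs) (fibres ks xs))

  fibres-[] : ∀ ks → fibres ks [] ≡ []
  fibres-[] [] = refl
  fibres-[] (k ∷ ks) = fibres-[] ks

  fibres-↭ : ∀ ks xs → Unique ks → (∀ {x} → x ∈ xs → key x ∈ ks) → fibres ks xs ↭ xs
  fibres-↭ ks [] _ _ rewrite fibres-[] ks = refl
  fibres-↭ ks (x ∷ xs) u covers =
    ↭-trans (fibres-∈ ks x xs u (covers (here refl))) (prep x (fibres-↭ ks xs u (covers ∘ there)))

Nonempty : ∀ {n} → Cell n → Set
Nonempty C = ∃ (_∈ C)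

Refines : ∀ {n} → Coloring n → Coloring n → Set
Refines π' π = ∀ {C'} → C' ∈ π' → ∃ λ C → C ∈ π × C' ⊆ C

IsPartition : ∀ {n} → Coloring n → Set
IsPartition {n} π = All Nonempty π × concat π ↭ allFin n

Separated : ∀ {n} → Coloring n → Set
Separated π = All Nonempty π × Unique (concat π)

IsPartition⇒Separated : ∀ {n} {π : Coloring n} → IsPartition π → Separated π
IsPartition⇒Separated {n} (ne , p) = ne , Unique-↭ (↭-sym p) (allFin⁺ n)

length-nonempty-cells : ∀ {n} (π : Coloring n) → All Nonempty π → length π ≤ length (concat π)
length-nonempty-cells [] [] = z≤n
length-nonempty-cells ((x ∷ X) ∷ π) (_ ∷ ne) = begin
  suc (length π)                 ≤⟨ s≤s (length-nonempty-cells π ne) ⟩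
  suc (length (concat π))        ≤⟨ s≤s (ℕ.m≤n+m _ (length X)) ⟩
  suc (length X + length (concat π)) ≡⟨ cong suc (List.length-++ X) ⟨
  length ((x ∷ X) ++ concat π)   ∎
  where open ℕ.≤-Reasoning

length-partition : ∀ {n} {π : Coloring n} → IsPartition π → length π ≤ n
length-partition {n} {π} (ne , p) = ℕ.≤-trans (length-nonempty-cells π ne)
  (ℕ.≤-reflexive (≡-trans (↭-length p) (List.length-tabulate {n = n} (λ i → i))))

module _ {n : ℕ} (G : Graph n) where

  degIn-++ : ∀ A B x → degIn G (A ++ B) x ≡ degIn G A x + degIn G B x
  degIn-++ A B x rewrite List.filter-++ (T? ∘ adj G x) A B = List.length-++ (filterᵇ (adj G x) A)

  degIn-↭ : ∀ {A B} x → A ↭ B → degIn G A x ≡ degIn G B x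
  degIn-↭ x p = ↭-length (filter-↭ _ p)

  degIn-≤ : ∀ A x → degIn G A x ≤ length A
  degIn-≤ A x = List.length-filter _ A

  Uniform : Cell n → Coloring n → Set
  Uniform U π = ∀ {C} → C ∈ π → ∀ {x y} → x ∈ C → y ∈ C → degIn G U x ≡ degIn G U y

  IsEquitable : Coloring n → Set
  IsEquitable π = ∀ {U} → U ∈ π → Uniform U π

  Uniform-refines : ∀ {U π π'} → Refines π' π → Uniform U π → Uniform U π'
  Uniform-refines π'⊑π h C'∈ x∈ y∈ = let _ , C∈ , C'⊆C = π'⊑π C'∈ in h C∈ (C'⊆C x∈) (C'⊆C y∈)

  Uniform-↭ : ∀ {U U' π} → U ↭ U' → Uniform U π → Uniform U' π
  Uniform-↭ p h C∈ {x} {y} x∈ y∈ = ≡-trans (sym (degIn-↭ x p)) (≡-trans (h C∈ x∈ y∈) (degIn-↭ y p))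

  Uniform-++ : ∀ {U V π} → Uniform U π → Uniform V π → Uniform (U ++ V) π
  Uniform-++ {U} {V} hU hV C∈ {x} {y} x∈ y∈
    rewrite degIn-++ U V x | degIn-++ U V y = cong₂ _+_ (hU C∈ x∈ y∈) (hV C∈ x∈ y∈)

  Uniform-++⁻ˡ : ∀ {U V π} → Uniform (U ++ V) π → Uniform V π → Uniform U π
  Uniform-++⁻ˡ {U} {V} hUV hV C∈ {x} {y} x∈ y∈ = ℕ.+-cancelʳ-≡ (degIn G V x) _ _ (begin
    degIn G U x + degIn G V x ≡⟨ degIn-++ U V x ⟨
    degIn G (U ++ V) x        ≡⟨ hUV C∈ x∈ y∈ ⟩
    degIn G (U ++ V) y        ≡⟨ degIn-++ U V y ⟩
    degIn G U y + degIn G V y ≡⟨ cong (degIn G U y +_) (hV C∈ x∈ y∈) ⟨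
    degIn G U y + degIn G V x ∎)
    where open ≡-Reasoning

  Uniform-concat : ∀ {Zs π} → (∀ {Z} → Z ∈ Zs → Uniform Z π) → Uniform (concat Zs) π
  Uniform-concat {[]} h C∈ x∈ y∈ = refl
  Uniform-concat {Z ∷ Zs} {π} h = Uniform-++ {Z} {concat Zs} {π} (h (here refl)) (Uniform-concat {Zs} {π} (h ∘ there))

module _ {n : ℕ} where

  colorOf-++-∉ : ∀ (L R : Coloring n) {u} → (∀ {C} → C ∈ L → u ∉ C) → colorOf (L ++ R) u ≡ length L + colorOf R u
  colorOf-++-∉ [] R _ = refl
  colorOf-++-∉ (C ∷ L) R u∉ rewrite ∉⇒∈ᵇ-false (u∉ (here refl)) = cong suc (colorOf-++-∉ L R (u∉ ∘ there))

  colorOf-++-∈ : ∀ (L R : Coloring n) {u C} → C ∈ L → u ∈ C → colorOf (L ++ R) u < length L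
  colorOf-++-∈ (D ∷ L) R {u} C∈ u∈C with u ∈ᵇ D in eq
  ... | true = s≤s z≤n
  colorOf-++-∈ (D ∷ L) R (here refl) u∈C | false = contradiction u∈C (∈ᵇ-false⇒∉ eq)
  colorOf-++-∈ (D ∷ L) R (there C∈) u∈C  | false = s≤s (colorOf-++-∈ L R C∈ u∈C)

module _ {n : ℕ} (f : Cell n → List (Cell n)) where

  ∈-concatMap⁻′ : ∀ π {C} → C ∈ concatMap f π → ∃ λ X → X ∈ π × C ∈ f X
  ∈-concatMap⁻′ π C∈ = find (∈-concatMap⁻ f C∈)

  ∈-concatMap⁺′ : ∀ {π X C} → X ∈ π → C ∈ f X → C ∈ concatMap f π
  ∈-concatMap⁺′ X∈ C∈ = ∈-concatMap⁺ f (lose X∈ C∈)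

  concat-concatMap : ∀ π → (∀ {X} → X ∈ π → concat (f X) ↭ X) → concat (concatMap f π) ↭ concat π
  concat-concatMap [] _ = refl
  concat-concatMap (X ∷ π) h rewrite sym (List.concat-++ (f X) (concatMap f π)) =
    ++⁺ (h (here refl)) (concat-concatMap π (h ∘ there))

  concatMap-identity : ∀ π → (∀ {X} → X ∈ π → f X ≡ [ X ]) → concatMap f π ≡ π
  concatMap-identity [] _ = refl
  concatMap-identity (X ∷ π) h rewrite h (here refl) = cong (X ∷_) (concatMap-identity π (h ∘ there))

  concatMap-refines : (∀ {X C} → C ∈ f X → C ⊆ X) → ∀ π → Refines (concatMap f π) π
  concatMap-refines sub π C∈ = let X , X∈ , C∈fX = ∈-concatMap⁻′ π C∈ in X , X∈ , sub C∈fX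

  concatMap-⪯ : (∀ {X C} → C ∈ f X → C ⊆ X) → (∀ {X x} → x ∈ X → ∃ λ C → C ∈ f X × x ∈ C) →
                ∀ π → concatMap f π ⪯ π
  concatMap-⪯ sub cover (X ∷ π) u v lt with u ∈ᵇ X in eu | v ∈ᵇ X in ev
  ... | true  | true  = contradiction lt (ℕ.<-irrefl refl)
  ... | false | true  = contradiction lt λ ()
  ... | true  | false = let C , C∈ , u∈C = cover (∈ᵇ⇒∈ X eu) in begin-strict
    colorOf (f X ++ concatMap f π) u  <⟨ colorOf-++-∈ (f X) _ C∈ u∈C ⟩
    length (f X)                      ≤⟨ ℕ.m≤m+n (length (f X)) _ ⟩
    length (f X) + colorOf (concatMap f π) v ≡⟨ colorOf-++-∉ (f X) _ (λ D∈ v∈D → ∈ᵇ-false⇒∉ ev (sub D∈ v∈D)) ⟨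
    colorOf (f X ++ concatMap f π) v  ∎
    where open ℕ.≤-Reasoning
  ... | false | false
    rewrite colorOf-++-∉ (f X) (concatMap f π) (λ D∈ u∈D → ∈ᵇ-false⇒∉ eu (sub D∈ u∈D))
          | colorOf-++-∉ (f X) (concatMap f π) (λ D∈ v∈D → ∈ᵇ-false⇒∉ ev (sub D∈ v∈D))
    = ℕ.+-monoʳ-< (length (f X)) (concatMap-⪯ sub cover π u v (ℕ.≤-pred lt))

-- Splitting cells by their numbers of neighbours in W

module _ {n : ℕ} where

  largestLast : List (Cell n) → List (Cell n)
  largestLast Cs = proj₂ (extract (maxLen Cs) Cs) ++ [ proj₁ (extract (maxLen Cs) Cs) ]

  extract-↭ : ∀ m (Cs : List (Cell n)) → Any (λ C → length C ≡ m) Cs → proj₁ (extract m Cs) ∷ proj₂ (extract m Cs) ↭ Cs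
  extract-↭ m (C ∷ Cs) _ with length C ≡ᵇ m in eq
  ... | true = refl
  extract-↭ m (C ∷ Cs) (here p)  | false = contradiction (≡-trans (sym (≡⇒≡ᵇ p)) eq) true≢false
  extract-↭ m (C ∷ Cs) (there a) | false = ↭-trans (swap _ C refl) (prep C (extract-↭ m Cs a))

  maxLen-attained : ∀ (C : Cell n) Cs → Any (λ D → length D ≡ maxLen (C ∷ Cs)) (C ∷ Cs)
  maxLen-attained C [] = here (sym (ℕ.⊔-identityʳ (length C)))
  maxLen-attained C (C' ∷ Cs) with ℕ.⊔-sel (length C) (maxLen (C' ∷ Cs))
  ... | inj₁ eq = here (sym eq)
  ... | inj₂ eq rewrite eq = there (maxLen-attained C' Cs)

  largestLast-↭ : ∀ (C : Cell n) Cs → largestLast (C ∷ Cs) ↭ C ∷ Cs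
  largestLast-↭ C Cs = ↭-trans (++-comm (proj₂ e) [ proj₁ e ]) (extract-↭ _ (C ∷ Cs) (maxLen-attained C Cs))
    where e = extract (maxLen (C ∷ Cs)) (C ∷ Cs)

  ∈-largestLast⁻ : ∀ (Cs : List (Cell n)) {C} → C ∈ largestLast Cs → C ∈ Cs ⊎ (Cs ≡ [] × C ≡ [])
  ∈-largestLast⁻ [] (here refl) = inj₂ (refl , refl)
  ∈-largestLast⁻ (D ∷ Ds) C∈ = inj₁ (∈-resp-↭ (largestLast-↭ D Ds) C∈)

  concat-largestLast : ∀ (Cs : List (Cell n)) → concat (largestLast Cs) ↭ concat Cs
  concat-largestLast [] = refl
  concat-largestLast (C ∷ Cs) = concat-↭ (largestLast-↭ C Cs)

  largestLast-[_] : ∀ (X : Cell n) → largestLast [ X ] ≡ [ X ]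
  largestLast-[ X ] rewrite ℕ.⊔-identityʳ (length X) | ≡ᵇ-refl (length X) = refl

  copies⇒[_] : ∀ (X : Cell n) {Cs} → 0 < length X → (∀ {C} → C ∈ Cs → C ≡ X) → length (concat Cs) ≡ length X → Cs ≡ [ X ]
  copies⇒[ X ] {[]} pos _ len = contradiction (sym len) (ℕ.>⇒≢ pos)
  copies⇒[ X ] {C ∷ []} _ same _ = cong [_] (same (here refl))
  copies⇒[ X ] {C ∷ C' ∷ Cs} pos same len rewrite same (here refl) | same (there (here refl)) =
    contradiction (ℕ.m<m+n (length X) rest>0) (subst (λ k → ¬ length X < k) (≡-trans (sym len) (List.length-++ X)) (ℕ.<-irrefl refl))
    where
    rest>0 : 0 < length (X ++ concat Cs)
    rest>0 = subst (0 <_) (sym (List.length-++ X)) (ℕ.<-≤-trans pos (ℕ.m≤m+n _ _))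

nonnull⇒Nonempty : ∀ {n} {C : Cell n} → not (null C) ≡ true → Nonempty C
nonnull⇒Nonempty {C = x ∷ _} _ = x , here refl

module Splitting {n : ℕ} (G : Graph n) (W : Cell n) where

  open Fibres _≡ᵇ_ ≡ᵇ⇒≡ ≡ᵇ-refl (degIn G W)

  -- definitionally largestLast (classes G W X)
  fragments : Cell n → List (Cell n)
  fragments X = proj₁ (splitCell G W X) ++ [ proj₂ (splitCell G W X) ]

  concat-classes : ∀ X → concat (classes G W X) ↭ X
  concat-classes X rewrite concat-nonnull (map (λ k → fibre k X) (upTo (suc (length W)))) =
    fibres-↭ (upTo (suc (length W))) X (upTo⁺ _) (λ {x} _ → ∈-upTo⁺ (s≤s (degIn-≤ G W x)))

  ∈-classes⁻ : ∀ X {C} → C ∈ classes G W X → (∃ λ k → C ≡ fibre k X) × Nonempty C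
  ∈-classes⁻ X C∈ with ∈-filterᵇ⁻ (not ∘ null) _ C∈
  ... | C∈fibres , nonnull with ∈-map⁻ (λ k → fibre k X) C∈fibres
  ...   | k , _ , refl = (k , refl) , nonnull⇒Nonempty nonnull

  class-⊆ : ∀ {X C} → C ∈ classes G W X → C ⊆ X
  class-⊆ {X} C∈ with ∈-classes⁻ X C∈
  ... | (k , refl) , _ = proj₁ ∘ ∈-filterᵇ⁻ _ X

  class-uniform : ∀ {X C} → C ∈ classes G W X → ∀ {x y} → x ∈ C → y ∈ C → degIn G W x ≡ degIn G W y
  class-uniform {X} C∈ x∈ y∈ with ∈-classes⁻ X C∈
  ... | (k , refl) , _ = ≡-trans (≡ᵇ⇒≡ (proj₂ (∈-filterᵇ⁻ _ X x∈))) (sym (≡ᵇ⇒≡ (proj₂ (∈-filterᵇ⁻ _ X y∈))))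

  classes-[] : ∀ (ks : List ℕ) → filterᵇ (not ∘ null) (map (λ k → fibre k []) ks) ≡ []
  classes-[] [] = refl
  classes-[] (k ∷ ks) = classes-[] ks

  concat-fragments : ∀ X → concat (fragments X) ↭ X
  concat-fragments X = ↭-trans (concat-largestLast (classes G W X)) (concat-classes X)

  fragment-⊆ : ∀ {X C} → C ∈ fragments X → C ⊆ X
  fragment-⊆ {X} C∈ with ∈-largestLast⁻ (classes G W X) C∈
  ... | inj₁ C∈classes = class-⊆ C∈classes
  ... | inj₂ (_ , refl) = λ ()

  fragment-uniform : ∀ {X C} → C ∈ fragments X → ∀ {x y} → x ∈ C → y ∈ C → degIn G W x ≡ degIn G W y
  fragment-uniform {X} C∈ with ∈-largestLast⁻ (classes G W X) C∈
  ... | inj₁ C∈classes = class-uniform {X} C∈classes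
  ... | inj₂ (_ , refl) = λ ()

  fragment-nonempty : ∀ {X C} → Nonempty X → C ∈ fragments X → Nonempty C
  fragment-nonempty {X} (x , x∈) C∈ with ∈-largestLast⁻ (classes G W X) C∈
  ... | inj₁ C∈classes = proj₂ (∈-classes⁻ X C∈classes)
  ... | inj₂ (none , _) = contradiction (subst (λ Cs → x ∈ concat Cs) none (∈-resp-↭ (↭-sym (concat-classes X)) x∈)) λ ()

  fragments-uniform : ∀ X → (∀ {x y} → x ∈ X → y ∈ X → degIn G W x ≡ degIn G W y) → fragments X ≡ [ X ]
  fragments-uniform [] _ = cong largestLast (classes-[] (upTo (suc (length W))))
  fragments-uniform X@(_ ∷ _) uniform = begin
    largestLast (classes G W X) ≡⟨ cong largestLast (copies⇒[ X ] (s≤s z≤n) class≡X (↭-length (concat-classes X))) ⟩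
    largestLast [ X ]           ≡⟨ largestLast-[ X ] ⟩
    [ X ]                       ∎
    where
    open ≡-Reasoning
    class≡X : ∀ {C} → C ∈ classes G W X → C ≡ X
    class≡X C∈ with ∈-classes⁻ X C∈
    ... | (k , refl) , (c , c∈) =
      let c∈X , deg-c≡k = ∈-filterᵇ⁻ (λ v → degIn G W v ≡ᵇ k) X c∈ in
      filterᵇ-all (λ v → degIn G W v ≡ᵇ k) X (λ y∈ → ≡-trans (cong (_≡ᵇ k) (uniform y∈ c∈X)) deg-c≡k)

  splitCells-identity : ∀ π → Uniform G W π → splitCells G W π ≡ π
  splitCells-identity π h = concatMap-identity fragments π (λ X∈ → fragments-uniform _ (h X∈))

  concat-splitCells : ∀ π → concat (splitCells G W π) ↭ concat π
  concat-splitCells π = concat-concatMap fragments π (λ {X} _ → concat-fragments X)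

  splitCells-refines : ∀ π → Refines (splitCells G W π) π
  splitCells-refines = concatMap-refines fragments fragment-⊆

  splitCells-uniform : ∀ π → Uniform G W (splitCells G W π)
  splitCells-uniform π C∈ = let X , _ , C∈fX = ∈-concatMap⁻′ fragments π C∈ in fragment-uniform {X} C∈fX

  splitCells-partition : ∀ {π} → IsPartition π → IsPartition (splitCells G W π)
  splitCells-partition {π} (ne , p) =
    All.tabulate (λ C∈ → let _ , X∈ , C∈fX = ∈-concatMap⁻′ fragments π C∈ in fragment-nonempty (All.lookup ne X∈) C∈fX) ,
    ↭-trans (concat-splitCells π) p

  splitCells-⪯ : ∀ π → splitCells G W π ⪯ π
  splitCells-⪯ = concatMap-⪯ fragments fragment-⊆
    (λ {X} x∈ → let C , C∈ , x∈C = find (∈-concat⁻ (fragments X) (∈-resp-↭ (↭-sym (concat-fragments X)) x∈)) in C , C∈ , x∈C)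

module _ {n : ℕ} where

  singleton : ∀ (X : Cell n) → (length X ≡ᵇ 1) ≡ true → ∃ λ x → X ≡ [ x ]
  singleton (x ∷ []) _ = x , refl

  ∈-replaceCell-≢ : ∀ {X Y Z : Cell n} {α} → Y ≢ X → Y ∈ α → Y ∈ replaceCell X Z α
  ∈-replaceCell-≢ {X} {Y} Y≢X (here refl) with Y ==c X in eq
  ... | true  = contradiction (==c⇒≡ eq) Y≢X
  ... | false = here refl
  ∈-replaceCell-≢ Y≢X (there Y∈) = there (∈-replaceCell-≢ Y≢X Y∈)

  ∈-replaceCell : ∀ {X Z : Cell n} {α} → X ∈ α → Z ∈ replaceCell X Z α
  ∈-replaceCell {X} (here refl) rewrite ==c-refl X = here refl
  ∈-replaceCell (there X∈) = there (∈-replaceCell X∈)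

  ∈-removeCell-≢ : ∀ {W Y : Cell n} {α} → Y ≢ W → Y ∈ α → Y ∈ removeCell W α
  ∈-removeCell-≢ {W} {Y} Y≢W (here refl) with Y ==c W in eq
  ... | true  = contradiction (==c⇒≡ eq) Y≢W
  ... | false = here refl
  ∈-removeCell-≢ {W} {α = C ∷ α} Y≢W (there Y∈) with C ==c W
  ... | true  = Y∈
  ... | false = there (∈-removeCell-≢ Y≢W Y∈)

  length-removeCell : ∀ {W : Cell n} {α} → W ∈ α → suc (length (removeCell W α)) ≡ length α
  length-removeCell {W} (here refl) rewrite ==c-refl W = refl
  length-removeCell {W} {C ∷ α} (there W∈) with C ==c W
  ... | true  = refl
  ... | false = cong suc (length-removeCell W∈)

  Separated-∷⇒≢ : ∀ {X : Cell n} {π} → Separated (X ∷ π) → ∀ {Y : Cell n} → Nonempty Y → Y ⊆ X → ∀ {X'} → X' ∈ π → Y ≢ X'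
  Separated-∷⇒≢ {X} (_ , u) (y , y∈) Y⊆X X'∈ refl = Unique-++⇒disjoint X u (Y⊆X y∈) (∈-concat⁺′ y∈ X'∈)

  Separated-tail : ∀ {X : Cell n} {π} → Separated (X ∷ π) → Separated π
  Separated-tail {X} (_ ∷ ne , u) = ne , Unique-++⁻ʳ X u

module Refinement {n : ℕ} (G : Graph n) (W : Cell n) where

  open Splitting G W public

  smaller : Cell n → List (Cell n)
  smaller X = proj₁ (splitCell G W X)

  largest : Cell n → Cell n
  largest X = proj₂ (splitCell G W X)

  split-[_] : ∀ x → smaller [ x ] ≡ [] × largest [ x ] ≡ [ x ]
  split-[ x ] = List.∷ʳ-injective (smaller [ x ]) [] (fragments-uniform [ x ] λ { (here refl) (here refl) → refl })

  refineStep-splits : ∀ π α → proj₁ (refineStep G W π α) ≡ splitCells G W π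
  refineStep-splits [] α = refl
  refineStep-splits (X ∷ Xs) α with length X ≡ᵇ 1 in eq
  ... | true with singleton X eq
  ...   | x , refl rewrite proj₁ split-[ x ] | proj₂ split-[ x ] = cong ([ x ] ∷_) (refineStep-splits Xs α)
  refineStep-splits (X ∷ Xs) α | false =
    ≡-trans (cong (λ π → smaller X ++ largest X ∷ π) (refineStep-splits Xs _)) (sym (List.++-assoc (smaller X) _ _))

  refineStep-length : ∀ π α →
    length (proj₂ (refineStep G W π α)) + length π ≡ length α + length (proj₁ (refineStep G W π α))
  refineStep-length [] α = refl
  refineStep-length (X ∷ Xs) α with length X ≡ᵇ 1
  ... | true = ≡-trans (ℕ.+-suc _ (length Xs)) (≡-trans (cong suc (refineStep-length Xs α)) (sym (ℕ.+-suc (length α) _)))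
  ... | false = begin
    a + suc (length Xs)     ≡⟨ ℕ.+-suc a _ ⟩
    suc (a + length Xs)     ≡⟨ cong suc (refineStep-length Xs β) ⟩
    suc (length β + p)      ≡⟨ cong (λ b → suc (b + p)) length-β ⟩
    suc (length α + r + p)  ≡⟨ rearrange (length α) r p ⟩
    length α + (r + suc p)  ≡⟨ cong (length α +_) (List.length-++ (smaller X)) ⟨
    length α + length (smaller X ++ largest X ∷ proj₁ (refineStep G W Xs β)) ∎
    where
    open ≡-Reasoning
    β = replaceCell X (largest X) α ++ smaller X
    a = length (proj₂ (refineStep G W Xs β))
    p = length (proj₁ (refineStep G W Xs β))
    r = length (smaller X)
    length-β : length β ≡ length α + r
    length-β = ≡-trans (List.length-++ (replaceCell X (largest X) α)) (cong (_+ r) (List.length-map _ α))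
    rearrange : ∀ a r p → suc (a + r + p) ≡ a + (r + suc p)
    rearrange = solve-∀

  queued-untouched : ∀ π {β Y} → Y ∈ β → (∀ {X} → X ∈ π → Y ≢ X) → Y ∈ proj₂ (refineStep G W π β)
  queued-untouched [] Y∈ _ = Y∈
  queued-untouched (X ∷ Xs) Y∈ Y≢ with length X ≡ᵇ 1
  ... | true  = queued-untouched Xs Y∈ (Y≢ ∘ there)
  ... | false = queued-untouched Xs (∈-++⁺ˡ (∈-replaceCell-≢ (Y≢ (here refl)) Y∈)) (Y≢ ∘ there)

  smaller-queued : ∀ P X S {β} → Separated (P ++ X ∷ S) → ∀ {C} → C ∈ smaller X → C ∈ proj₂ (refineStep G W (P ++ X ∷ S) β)
  smaller-queued [] X S sep C∈ with length X ≡ᵇ 1 in eq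
  ... | true with singleton X eq
  ...   | x , refl rewrite proj₁ split-[ x ] with () ← C∈
  smaller-queued [] X S sep C∈ | false = queued-untouched S (∈-++⁺ʳ _ C∈)
    (Separated-∷⇒≢ sep (fragment-nonempty (All.lookup (proj₁ sep) (here refl)) C∈frag) (fragment-⊆ C∈frag))
    where C∈frag = ∈-++⁺ˡ C∈
  smaller-queued (X₀ ∷ P) X S sep C∈ with length X₀ ≡ᵇ 1
  ... | true  = smaller-queued P X S (Separated-tail sep) C∈
  ... | false = smaller-queued P X S (Separated-tail sep) C∈

  largest-queued : ∀ P X S {β} → Separated (P ++ X ∷ S) → X ∈ β → largest X ∈ proj₂ (refineStep G W (P ++ X ∷ S) β)
  largest-queued [] X S sep X∈ with length X ≡ᵇ 1 in eq
  ... | true with singleton X eq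
  ...   | x , refl rewrite proj₂ split-[ x ] =
    queued-untouched S X∈ (Separated-∷⇒≢ sep (x , here refl) (λ y∈ → y∈))
  largest-queued [] X S sep X∈ | false = queued-untouched S (∈-++⁺ˡ (∈-replaceCell X∈))
    (Separated-∷⇒≢ sep (fragment-nonempty (All.lookup (proj₁ sep) (here refl)) largest∈) (fragment-⊆ largest∈))
    where largest∈ = ∈-++⁺ʳ (smaller X) (here refl)
  largest-queued (X₀ ∷ P) X S sep X∈ with length X₀ ≡ᵇ 1
  ... | true  = largest-queued P X S (Separated-tail sep) X∈
  ... | false = largest-queued P X S (Separated-tail sep) (∈-++⁺ˡ (∈-replaceCell-≢ X≢X₀ X∈))
    where X≢X₀ = λ eq → Separated-∷⇒≢ sep (All.lookup (proj₁ sep) (here refl)) (λ y∈ → y∈) (∈-++⁺ʳ P (here refl)) (sym eq)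

-- The invariant of make-equitable

++≡++∷ : ∀ {A : Set} (xs ys P : List A) y S → xs ++ ys ≡ P ++ y ∷ S →
  (∃ λ R → xs ≡ P ++ y ∷ R) ⊎ (∃ λ P' → P ≡ xs ++ P' × ys ≡ P' ++ y ∷ S)
++≡++∷ [] ys P y S eq = inj₂ (P , refl , eq)
++≡++∷ (x ∷ xs) ys [] y S refl = inj₁ (xs , refl)
++≡++∷ (x ∷ xs) ys (p ∷ P) y S eq with List.∷-injective eq
... | refl , eq′ with ++≡++∷ xs ys P y S eq′
...   | inj₁ (R , e) = inj₁ (R , cong (x ∷_) e)
...   | inj₂ (P' , e₁ , e₂) = inj₂ (P' , cong (x ∷_) e₁ , e₂)

[_]≡++∷ : ∀ {A : Set} (x : A) {Q y S} → [ x ] ≡ Q ++ y ∷ S → Q ≡ [] × y ≡ x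
[ x ]≡++∷ {Q = []} refl = refl , refl
[ x ]≡++∷ {Q = _ ∷ []} ()
[ x ]≡++∷ {Q = _ ∷ _ ∷ _} ()

∷ʳ≡++∷ : ∀ {A : Set} (xs : List A) x Q y R → xs ∷ʳ x ≡ Q ++ y ∷ R → y ∈ xs ⊎ (Q ≡ xs × y ≡ x)
∷ʳ≡++∷ [] x [] y R refl = inj₂ (refl , refl)
∷ʳ≡++∷ [] x (q ∷ []) y R ()
∷ʳ≡++∷ [] x (q ∷ _ ∷ _) y R ()
∷ʳ≡++∷ (z ∷ xs) x [] y R refl = inj₁ (here refl)
∷ʳ≡++∷ (z ∷ xs) x (q ∷ Q) y R eq with List.∷-injective eq
... | refl , eq′ with ∷ʳ≡++∷ xs x Q y R eq′
...   | inj₁ y∈ = inj₁ (there y∈)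
...   | inj₂ (e , refl) = inj₂ (cong (z ∷_) e , refl)

concatMap≡++∷ : ∀ {A B : Set} (f : A → List B) π P' Y S' → concatMap f π ≡ P' ++ Y ∷ S' →
  ∃ λ P → ∃ λ X → ∃ λ S → ∃ λ Q → ∃ λ R → π ≡ P ++ X ∷ S × f X ≡ Q ++ Y ∷ R × P' ≡ concatMap f P ++ Q
concatMap≡++∷ f [] [] Y S' ()
concatMap≡++∷ f [] (_ ∷ _) Y S' ()
concatMap≡++∷ f (X ∷ π) P' Y S' eq with ++≡++∷ (f X) (concatMap f π) P' Y S' eq
... | inj₁ (R , e) = [] , X , π , P' , R , refl , e , refl
... | inj₂ (P'' , e₁ , e₂) =
  let P , X' , S , Q , R , eπ , eX , eP = concatMap≡++∷ f π P'' Y S' e₂ in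
  X ∷ P , X' , S , Q , R , cong (X ∷_) eπ , eX ,
  ≡-trans e₁ (≡-trans (cong (f X ++_) eP) (sym (List.++-assoc (f X) (concatMap f P) Q)))

concat-∷ʳ : ∀ {A : Set} (xss : List (List A)) xs → concat (xss ∷ʳ xs) ↭ xs ++ concat xss
concat-∷ʳ xss xs rewrite sym (List.concat-++ xss [ xs ]) | List.++-identityʳ xs = ++-comm (concat xss) xs

module Settling {n : ℕ} (G : Graph n) where

  Settled : Coloring n → List (Cell n) → Set
  Settled π α = ∀ P Y S → π ≡ P ++ Y ∷ S → Y ∉ α → ∃ λ Zs → Zs ⊆ P × Uniform G (Y ++ concat Zs) π

  unqueued-prefix-uniform : ∀ {π α} → Settled π α → ∀ P S → Reverse P → π ≡ P ++ S →
    (∀ {Y} → Y ∈ P → Y ∉ α) → ∀ {Y} → Y ∈ P → Uniform G Y π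
  unqueued-prefix-uniform settled .[] S [] _ _ ()
  unqueued-prefix-uniform {π} settled .(P ∷ʳ X) S (P ∶ rev ∶ʳ X) eq unqueued Y∈ =
    [ earlier , (λ { (here refl) → uniformX }) ]′ (∈-++⁻ P Y∈)
    where
    eq′ = ≡-trans eq (List.++-assoc P [ X ] S)
    earlier = unqueued-prefix-uniform settled P (X ∷ S) rev eq′ (unqueued ∘ ∈-++⁺ˡ)
    uniformX : Uniform G X π
    uniformX = let Zs , Zs⊆P , uniformX++Zs = settled P X S eq′ (unqueued (∈-++⁺ʳ P (here refl))) in
      Uniform-++⁻ˡ G {X} {concat Zs} {π} uniformX++Zs (Uniform-concat G {Zs} {π} (earlier ∘ Zs⊆P))

  settled⇒equitable : ∀ {π α} → Settled π α → (∀ {Y} → Y ∈ π → Y ∉ α) → IsEquitable G π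
  settled⇒equitable {π} settled unqueued =
    unqueued-prefix-uniform settled π [] (reverseView π) (sym (List.++-identityʳ π)) unqueued

  equitable⇒split-identity : ∀ {π} → IsEquitable G π → ∀ i → split G π i ≡ π
  equitable⇒split-identity {π} equitable i = Splitting.splitCells-identity G (lookup π i) π (equitable (∈-lookup i))

  module _ (W : Cell n) where

    open Refinement G W

    cell↭largest++smaller : ∀ X → X ↭ largest X ++ concat (smaller X)
    cell↭largest++smaller X = ↭-trans (↭-sym (concat-fragments X)) (concat-∷ʳ (smaller X) (largest X))

    largest-settled : ∀ {π α} P X S → π ≡ P ++ X ∷ S → Settled π α → X ∉ removeCell W α →
      ∃ λ Zs → Zs ⊆ concatMap fragments P ++ smaller X × Uniform G (largest X ++ concat Zs) (splitCells G W π)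
    largest-settled {π} P X S eπ settled X∉ with X ≟ᶜ W
    ... | yes refl = smaller W , ∈-++⁺ʳ _ , Uniform-↭ G (cell↭largest++smaller W) (splitCells-uniform π)
    ... | no X≢W with settled P X S eπ (X∉ ∘ ∈-removeCell-≢ X≢W)
    ...   | Zs , Zs⊆P , uniform =
      Zs′ , Zs′⊆ , Uniform-↭ G X++Zs↭ (Uniform-refines G {X ++ concat Zs} {π} (splitCells-refines π) uniform)
      where
      Zs′ = concatMap fragments Zs ++ smaller X
      Zs′⊆ : Zs′ ⊆ concatMap fragments P ++ smaller X
      Zs′⊆ C∈ with ∈-++⁻ (concatMap fragments Zs) C∈
      ... | inj₂ C∈smaller = ∈-++⁺ʳ _ C∈smaller
      ... | inj₁ C∈frags = let Z , Z∈ , C∈fZ = ∈-concatMap⁻′ fragments Zs C∈frags in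
        ∈-++⁺ˡ (∈-concatMap⁺′ fragments (Zs⊆P Z∈) C∈fZ)
      X++Zs↭ : X ++ concat Zs ↭ largest X ++ concat Zs′
      X++Zs↭ = begin
        X ++ concat Zs                                         ↭⟨ ++⁺ (cell↭largest++smaller X)
                                                                   (↭-sym (concat-concatMap fragments Zs (λ {Z} _ → concat-fragments Z))) ⟩
        (largest X ++ concat (smaller X)) ++ concat (concatMap fragments Zs) ≡⟨ List.++-assoc (largest X) _ _ ⟩
        largest X ++ concat (smaller X) ++ concat (concatMap fragments Zs) ↭⟨ ++⁺ˡ (largest X) (++-comm (concat (smaller X)) _) ⟩
        largest X ++ concat (concatMap fragments Zs) ++ concat (smaller X) ≡⟨ cong (largest X ++_) (List.concat-++ (concatMap fragments Zs) (smaller X)) ⟩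
        largest X ++ concat Zs′                                ∎
        where open PermutationReasoning

    settled-refineStep : ∀ {π α} → Separated π → Settled π α →
      Settled (proj₁ (refineStep G W π (removeCell W α))) (proj₂ (refineStep G W π (removeCell W α)))
    settled-refineStep {π} {α} sep settled P' Y' S' eq Y'∉
      with concatMap≡++∷ fragments π P' Y' S' (≡-trans (sym (refineStep-splits π (removeCell W α))) eq)
    ... | P , X , S , Q , R , refl , eX , refl with ∷ʳ≡++∷ (smaller X) (largest X) Q Y' R eX
    ...   | inj₁ Y'∈ = contradiction (smaller-queued P X S sep Y'∈) Y'∉
    ...   | inj₂ (refl , refl) =
      let Zs , Zs⊆ , uniform = largest-settled P X S refl settled (Y'∉ ∘ largest-queued P X S sep) in
      Zs , Zs⊆ , subst (Uniform G (largest X ++ concat Zs)) (sym (refineStep-splits π (removeCell W α))) uniform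

lookup-++∷ : ∀ {A : Set} (P : List A) W S (i : Fin (length (P ++ W ∷ S))) → toℕ i ≡ length P → lookup (P ++ W ∷ S) i ≡ W
lookup-++∷ [] W S Fin.zero _ = refl
lookup-++∷ (X ∷ P) W S (Fin.suc i) eq = lookup-++∷ P W S i (ℕ.suc-injective eq)

lookup-++∷-prefix : ∀ {A : Set} (P : List A) W S (j : Fin (length (P ++ W ∷ S))) → toℕ j < length P → lookup (P ++ W ∷ S) j ∈ P
lookup-++∷-prefix (X ∷ P) W S Fin.zero _ = here refl
lookup-++∷-prefix (X ∷ P) W S (Fin.suc j) lt = there (lookup-++∷-prefix P W S j (ℕ.≤-pred lt))

module _ {n : ℕ} where

  firstIn-nothing : ∀ (π : Coloring n) α → firstIn π α ≡ nothing → ∀ {Y} → Y ∈ π → Y ∉ α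
  firstIn-nothing (X ∷ π) α eq Y∈ with memCell X α in m
  firstIn-nothing (X ∷ π) α () Y∈ | true
  firstIn-nothing (X ∷ π) α eq (here refl) | false = memCell-false⇒∉ m
  firstIn-nothing (X ∷ π) α eq (there Y∈) | false = firstIn-nothing π α eq Y∈

  firstIn-just : ∀ (π : Coloring n) α {W} → firstIn π α ≡ just W →
    ∃₂ λ P S → π ≡ P ++ W ∷ S × (∀ {Y} → Y ∈ P → Y ∉ α) × W ∈ α
  firstIn-just (X ∷ π) α eq with memCell X α in m
  firstIn-just (X ∷ π) α refl | true = [] , π , refl , (λ ()) , memCell⇒∈ α m
  firstIn-just (X ∷ π) α eq | false =
    let P , S , eπ , unqueued , W∈ = firstIn-just π α eq in
    X ∷ P , S , cong (X ∷_) eπ , (λ { (here refl) → memCell-false⇒∉ m ; (there Y∈) → unqueued Y∈ }) , W∈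

  discrete⇒singletons : ∀ (π : Coloring n) → discrete π ≡ true → ∀ {C} → C ∈ π → ∃ λ c → C ≡ [ c ]
  discrete⇒singletons (X ∷ π) disc C∈ with length X ≡ᵇ 1 in eq
  discrete⇒singletons (X ∷ π) disc (here refl) | true = singleton X eq
  discrete⇒singletons (X ∷ π) disc (there C∈) | true = discrete⇒singletons π disc C∈

  discrete⇒equitable : ∀ (G : Graph n) π → discrete π ≡ true → IsEquitable G π
  discrete⇒equitable G π disc _ C∈ x∈ y∈ with discrete⇒singletons π disc C∈
  discrete⇒equitable G π disc _ C∈ (here refl) (here refl) | _ , refl = refl

-- Fuel: a step removes W from the queue and adds as many cells as the coloring gains,
-- so |α| + n < fuel + |π| is preserved.
fuel-decreases : ∀ n {a a' p p' f} → a' + p ≡ a + p' → suc a + n < suc f + p → a' + n < f + p'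
fuel-decreases n {a} {a'} {p} {p'} {f} eq lt = ℕ.+-cancelʳ-< p (a' + n) (f + p') (begin-strict
  a' + n + p   ≡⟨ swap-n a' n p ⟩
  a' + p + n   ≡⟨ cong (_+ n) eq ⟩
  a + p' + n   ≡⟨ swap-n a p' n ⟩
  a + n + p'   <⟨ ℕ.+-monoˡ-< p' (ℕ.≤-pred lt) ⟩
  f + p + p'   ≡⟨ swap-n f p p' ⟩
  f + p' + p   ∎)
  where
  open ℕ.≤-Reasoning
  swap-n : ∀ a b c → a + b + c ≡ a + c + b
  swap-n = solve-∀

module MakeEquitable {n : ℕ} {H : Set} (hash : Graph n → Coloring n → H) (G : Graph n) (π₀ : Coloring n) where

  open Settling G

  D : Fact n → Set
  D = Derivable hash G π₀

  Derived : List (Fin n) → Coloring n → Set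
  Derived ν π = D (R≡ ν π) × IsEquitable G π × IsPartition π

  conclude : ∀ {ν π} → D (R⪯ ν π) → IsEquitable G π → IsPartition π → Derived ν π
  conclude d equitable part = Equitable (equitable⇒split-identity equitable) d , equitable , part

  -- Cells before W split nothing, so W is the first cell whose split is strict.
  derive-splitCells : ∀ {ν} P W S → let π = P ++ W ∷ S in
    D (R⪯ ν π) → (∀ {Y} → Y ∈ P → Uniform G Y π) → D (R⪯ ν (splitCells G W π))
  derive-splitCells {ν} P W S d earlier with List.≡-dec _≟ᶜ_ (splitCells G W (P ++ W ∷ S)) (P ++ W ∷ S)
  ... | yes same = subst (D ∘ R⪯ ν) (sym same) d
  ... | no changed = subst (λ U → D (R⪯ ν (splitCells G U π))) W-at-i (SplitColoring i strict minimal d)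
    where
    open Splitting G
    π = P ++ W ∷ S
    i : Fin (length π)
    i = fromℕ< (subst (length P <_) (sym (List.length-++ P)) (ℕ.m<m+n (length P) (s≤s z≤n)))
    W-at-i : lookup π i ≡ W
    W-at-i = lookup-++∷ P W S i (Fin.toℕ-fromℕ< _)
    strict : split G π i ≺ π
    strict = subst (λ U → splitCells G U π ≺ π) (sym W-at-i) (splitCells-⪯ W π , changed)
    minimal : ∀ j → toℕ j < toℕ i → ¬ (split G π j ≺ π)
    minimal j j<i (_ , changedⱼ) = changedⱼ (splitCells-identity (lookup π j) π
      (earlier (lookup-++∷-prefix P W S j (subst (toℕ j <_) (Fin.toℕ-fromℕ< _) j<i))))

  derive-equitableLoop : ∀ f {π α ν} → D (R⪯ ν π) → IsPartition π → Settled π α → length α + n < f + length π →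
    Derived ν (equitableLoop f G π α)
  derive-equitableLoop zero {π} {α} _ part _ lt =
    contradiction (ℕ.≤-trans (length-partition part) (ℕ.m≤n+m n (length α))) (ℕ.<⇒≱ lt)
  derive-equitableLoop (suc f) {α = []} d part settled _ = conclude d (settled⇒equitable settled λ _ ()) part
  derive-equitableLoop (suc f) {π} {A ∷ α} d part settled lt with discrete π in disc | firstIn π (A ∷ α) in first
  ... | true  | _       = conclude d (discrete⇒equitable G π disc) part
  ... | false | nothing = conclude d (settled⇒equitable settled (firstIn-nothing π (A ∷ α) first)) part
  ... | false | just W with firstIn-just π (A ∷ α) first
  ...   | P , S , refl , unqueued , W∈ = derive-equitableLoop f d′ part′ (settled-refineStep W (IsPartition⇒Separated part) settled) lt′
    where
    open Refinement G W
    β = removeCell W (A ∷ α)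
    splits = sym (refineStep-splits π β)
    d′ = subst (D ∘ R⪯ _) splits
      (derive-splitCells P W S d (unqueued-prefix-uniform settled P (W ∷ S) (reverseView P) refl unqueued))
    part′ = subst IsPartition splits (splitCells-partition part)
    lt′ = fuel-decreases n (refineStep-length π β) (subst (λ a → a + n < suc f + length π) (sym (length-removeCell W∈)) lt)

-- Individualization

module Individualization {n : ℕ} (v : Fin n) where

  others : Cell n → Cell n
  others W = filterᵇ (λ u → not (u == v)) W

  rest : Cell n → List (Cell n)
  rest W = if null (others W) then [] else [ others W ]

  -- ind π v is definitionally concatMap pieces π
  pieces : Cell n → List (Cell n)
  pieces W = if v ∈ᵇ W then [ v ] ∷ rest W else [ W ]

  ≢⇒not-== : ∀ {u} → u ≢ v → not (u == v) ≡ true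
  ≢⇒not-== {u} u≢v with u == v in eq
  ... | true  = contradiction (==⇒≡ eq) u≢v
  ... | false = refl

  cell↭v∷others : ∀ {W} → Unique W → v ∈ W → W ↭ v ∷ others W
  cell↭v∷others {_ ∷ W} (v∉W ∷ _) (here refl) rewrite ==-refl v =
    prep v (↭-reflexive (sym (filterᵇ-all _ W (λ u∈ → ≢⇒not-== λ { refl → All.lookup v∉W u∈ refl }))))
  cell↭v∷others {x ∷ W} (x∉W ∷ u) (there v∈W) rewrite ≢⇒not-== (All.lookup x∉W v∈W) =
    ↭-trans (prep x (cell↭v∷others u v∈W)) (swap x v refl)

  concat-rest : ∀ W → concat (rest W) ≡ others W
  concat-rest W with others W
  ... | []     = refl
  ... | u ∷ us = List.++-identityʳ (u ∷ us)

  ∈-rest⁻ : ∀ W {C} → C ∈ rest W → C ≡ others W × Nonempty C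
  ∈-rest⁻ W C∈ with others W
  ∈-rest⁻ W (here refl) | u ∷ us = refl , u , here refl

  rest≡++∷ : ∀ W Q Y S → rest W ≡ Q ++ Y ∷ S → Q ≡ [] × Y ≡ others W
  rest≡++∷ W Q Y S eq with others W
  rest≡++∷ W [] Y S () | []
  rest≡++∷ W (_ ∷ _) Y S () | []
  rest≡++∷ W [] Y S refl | u ∷ us = refl , refl
  rest≡++∷ W (_ ∷ []) Y S () | u ∷ us
  rest≡++∷ W (_ ∷ _ ∷ _) Y S () | u ∷ us

  concat-pieces : ∀ {W} → Unique W → concat (pieces W) ↭ W
  concat-pieces {W} u with v ∈ᵇ W in v∈?
  ... | true rewrite concat-rest W = ↭-sym (cell↭v∷others u (∈ᵇ⇒∈ W v∈?))
  ... | false = ↭-reflexive (List.++-identityʳ W)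

  piece-⊆ : ∀ {W C} → C ∈ pieces W → C ⊆ W
  piece-⊆ {W} C∈ with v ∈ᵇ W in v∈?
  piece-⊆ {W} (here refl) | true = λ { (here refl) → ∈ᵇ⇒∈ W v∈? }
  piece-⊆ {W} (there C∈) | true with refl , _ ← ∈-rest⁻ W C∈ = proj₁ ∘ ∈-filterᵇ⁻ _ W
  piece-⊆ {W} (here refl) | false = λ u∈ → u∈

  piece-nonempty : ∀ {W C} → Nonempty W → C ∈ pieces W → Nonempty C
  piece-nonempty {W} ne C∈ with v ∈ᵇ W
  piece-nonempty {W} ne (here refl) | true = v , here refl
  piece-nonempty {W} ne (there C∈) | true = proj₂ (∈-rest⁻ W C∈)
  piece-nonempty {W} ne (here refl) | false = ne

  ind-partition : ∀ {π} → IsPartition π → IsPartition (ind π v)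
  ind-partition {π} part@(ne , p) =
    All.tabulate (λ C∈ → let _ , X∈ , C∈pX = ∈-concatMap⁻′ pieces π C∈ in piece-nonempty (All.lookup ne X∈) C∈pX) ,
    ↭-trans (concat-concatMap pieces π (concat-pieces ∘ Unique-concat⇒Unique π (proj₂ (IsPartition⇒Separated part)))) p

  -- A cell other than {v} is an old, uniform cell or the remainder of v's cell, which {v} completes.
  ind-settled : ∀ (G : Graph n) {π} → IsPartition π → IsEquitable G π → Settling.Settled G (ind π v) [ [ v ] ]
  ind-settled G {π} part equitable P' Y' S' eq Y'∉ with concatMap≡++∷ pieces π P' Y' S' eq
  ... | P , X , S , Q , R , refl , eX , refl with v ∈ᵇ X in v∈?
  ...   | false with refl , refl ← [ X ]≡++∷ eX =
    [] , (λ ()) , Uniform-↭ G (↭-sym (↭-reflexive (List.++-identityʳ X))) (Uniform-refines G {X} {π} refines uniformX)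
    where
    refines = concatMap-refines pieces piece-⊆ _
    uniformX = equitable (∈-++⁺ʳ P (here refl))
  ind-settled G {π} part equitable P' Y' S' eq Y'∉ | P , X , S , [] , R , refl , refl , refl | true = contradiction (here refl) Y'∉
  ind-settled G {π} part equitable P' Y' S' eq Y'∉ | P , X , S , _ ∷ Q , R , refl , eX , refl | true
    with refl , eX′ ← List.∷-injective eX with refl , refl ← rest≡++∷ X Q Y' R eX′ =
    [ [ v ] ] , (λ { (here refl) → ∈-++⁺ʳ _ (here refl) }) ,
    Uniform-↭ G X↭ (Uniform-refines G {X} {π} (concatMap-refines pieces piece-⊆ _) (equitable (∈-++⁺ʳ P (here refl))))
    where
    X↭ : X ↭ others X ++ v ∷ []
    X↭ = ↭-trans (cell↭v∷others (Unique-concat⇒Unique _ (proj₂ (IsPartition⇒Separated part)) (∈-++⁺ʳ P (here refl))) (∈ᵇ⇒∈ X v∈?))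
                 (++-comm [ v ] (others X))

-- Derivations of the refinement function and of equal invariants

Rbar-∷ʳ : ∀ {n} (G : Graph n) π₀ ν v → Rbar G π₀ (ν ∷ʳ v) ≡ make-equitable G (ind (Rbar G π₀ ν) v) [ [ v ] ]
Rbar-∷ʳ G π₀ ν v = List.foldl-∷ʳ _ _ v ν

prefixes-∷ʳ : ∀ {A : Set} (xs : List A) x → prefixes (xs ∷ʳ x) ≡ prefixes xs ∷ʳ (xs ∷ʳ x)
prefixes-∷ʳ [] x = refl
prefixes-∷ʳ (y ∷ xs) x = cong ([ y ] ∷_) (≡-trans (cong (map (y ∷_)) (prefixes-∷ʳ xs x)) (List.map-++ (y ∷_) (prefixes xs) _))

phibar-∷ʳ : ∀ {n} {H : Set} (hash : Graph n → Coloring n → H) G π₀ ν v →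
  phibar hash G π₀ (ν ∷ʳ v) ≡ phibar hash G π₀ ν ∷ʳ hash G (Rbar G π₀ (ν ∷ʳ v))
phibar-∷ʳ hash G π₀ ν v rewrite prefixes-∷ʳ ν v = List.map-++ _ (prefixes ν) _

length-∷ʳ : ∀ {A : Set} (xs : List A) x → length (xs ∷ʳ x) ≡ suc (length xs)
length-∷ʳ xs x = ≡-trans (List.length-++ xs) (ℕ.+-comm (length xs) 1)

fuel-suffices : ∀ a p → a < a + 1 + p
fuel-suffices a p = subst (λ b → a < b + p) (ℕ.+-comm 1 a) (ℕ.m≤m+n (suc a) p)

cellsOf-partition : ∀ {n m} (π₀ : Fin n → Fin m) → (∀ c → ∃ λ v → π₀ v ≡ c) → IsPartition (cellsOf π₀)
cellsOf-partition {n} {m} π₀ surjective =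
  All.tabulate nonempty , fibres-↭ (allFin m) (allFin n) (allFin⁺ m) (λ {v} _ → ∈-allFin (π₀ v))
  where
  open Fibres _==_ ==⇒≡ ==-refl π₀
  nonempty : ∀ {C} → C ∈ cellsOf π₀ → Nonempty C
  nonempty C∈ with ∈-map⁻ (λ c → fibre c (allFin n)) C∈
  ... | c , _ , refl with surjective c
  ...   | v , refl = v , ∈-filterᵇ⁺ _ (∈-allFin v) (==-refl (π₀ v))

module _ {n m : ℕ} {H : Set} (hash : Graph n → Coloring n → H) (G : Graph n)
  (π₀ : Fin n → Fin m) (surjective : ∀ c → ∃ λ v → π₀ v ≡ c) where

  open MakeEquitable hash G (cellsOf π₀)

  Rbar-derived : ∀ {ν} → Reverse ν → Derived ν (Rbar G (cellsOf π₀) ν)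
  Rbar-derived [] = derive-equitableLoop _ ColoringAxiom (cellsOf-partition π₀ surjective)
    (λ P Y S eq Y∉ → contradiction (subst (Y ∈_) (sym eq) (∈-++⁺ʳ P (here refl))) Y∉)
    (fuel-suffices _ _)
  Rbar-derived (ν ∶ rev ∶ʳ v) rewrite Rbar-∷ʳ G (cellsOf π₀) ν v =
    let d , equitable , part = Rbar-derived rev
        open Individualization v
    in derive-equitableLoop _ (Individualize v d) (ind-partition part) (ind-settled G part equitable) (fuel-suffices _ _)

  φ≡-derivable : ∀ {ν₁ ν₂} → Reverse ν₁ → Reverse ν₂ → length ν₁ ≡ length ν₂ →
    phibar hash G (cellsOf π₀) ν₁ ≡ phibar hash G (cellsOf π₀) ν₂ → D (φ≡ ν₁ ν₂)
  φ≡-derivable [] [] _ _ = InvariantAxiom []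
  φ≡-derivable [] (ν₂ ∶ _ ∶ʳ v₂) len _ = contradiction (≡-trans len (length-∷ʳ ν₂ v₂)) λ ()
  φ≡-derivable (ν₁ ∶ _ ∶ʳ v₁) [] len _ = contradiction (≡-trans (sym len) (length-∷ʳ ν₁ v₁)) λ ()
  φ≡-derivable (ν₁ ∶ rev₁ ∶ʳ v₁) (ν₂ ∶ rev₂ ∶ʳ v₂) len eq =
    InvariantsEqual hashes-equal (φ≡-derivable rev₁ rev₂ len′ prefixes-equal)
      (proj₁ (Rbar-derived (ν₁ ∶ rev₁ ∶ʳ v₁))) (proj₁ (Rbar-derived (ν₂ ∶ rev₂ ∶ʳ v₂)))
    where
    len′ = ℕ.suc-injective (≡-trans (sym (length-∷ʳ ν₁ v₁)) (≡-trans len (length-∷ʳ ν₂ v₂)))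
    last-equal = List.∷ʳ-injective (phibar hash G (cellsOf π₀) ν₁) (phibar hash G (cellsOf π₀) ν₂)
      (≡-trans (sym (phibar-∷ʳ hash G (cellsOf π₀) ν₁ v₁)) (≡-trans eq (phibar-∷ʳ hash G (cellsOf π₀) ν₂ v₂)))
    prefixes-equal = proj₁ last-equal
    hashes-equal = proj₂ last-equal

lemma4p17 : ∀ {n m : ℕ} (H : Set) (_<H_ : H → H → Set) → IsStrictTotalOrder _≡_ _<H_ →
    (hash : Graph n → Coloring n → H) → HashInvariant hash →
    (G : Graph n) (π₀ : Fin n → Fin m) → (∀ c → ∃ λ v → π₀ v ≡ c) →
    (ν₁ ν₂ : List (Fin n)) →
    IsNode G (cellsOf π₀) ν₁ → IsNode G (cellsOf π₀) ν₂ →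
    length ν₁ ≡ length ν₂ →
    phibar hash G (cellsOf π₀) ν₁ ≡ phibar hash G (cellsOf π₀) ν₂ →
    Derivable hash G (cellsOf π₀) (φ≡ ν₁ ν₂)
lemma4p17 _ _ _ hash _ G π₀ surjective ν₁ ν₂ _ _ =
  φ≡-derivable hash G π₀ surjective (reverseView ν₁) (reverseView ν₂)
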